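{- Let $G\in\mathscr{B}$ with $\operatorname{diam}(G)\ge 4$. Let $B$ be a block of $G$ with bipartition $(V_1(B),V_2(B))$ and let $u\in V_B$ be a vertex that is not a cut-vertex of $G$. (i) Suppose $B$ is a bridge block and $v_1,v_2$ are the cut-vertices of $G$ belonging to $B$, with $e(v_1)\le e(v_2)$. Then $e(u)=e(v_2)$ if $v_1,v_2,u\in V_1(B)$; $e(u)=e(v_2)-1$ if $v_1,v_2\in V_1(B)$ and $u\in V_2(B)$; $e(u)=e(v_2)+1$ if $v_1,u\in V_1(B)$ and $v_2\in V_2(B)$; $e(u)=e(v_1)+1$ if $v_1\in V_1(B)$ and $v_2,u\in V_2(B)$. (ii) If $B$ is a leaf block and $v$ is the cut-vertex of $G$ belonging to $B$, then $e(u)=e(v)+2$ if $u,v\in V_1(B)$ or $u,v\in V_2(B)$, and $e(u)=e(v)+1$ otherwise.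
   Context: All graphs are finite, simple and connected; $d(a,b)$ is the distance in $G$ and $e(u)=\max\{d(u,w):w\in V_G\}$ is the eccentricity; $\operatorname{diam}(G)=\max_u e(u)$. A block is a maximal connected subgraph without a cut-vertex; $C_G$ is the set of cut-vertices of $G$. A bi-block graph is a connected graph all of whose blocks are complete bipartite graphs. $\mathscr{B}$ is the class of bi-block graphs with at least two blocks in which every block contains at most two cut-vertices of $G$. A block $B$ is a bridge block if $|V_B\cap C_G|=2$ and a leaf block if $|V_B\cap C_G|=1$. -}

module Defs where

open import Data.Nat using (ℕ; zero; suc; _≤_; _<_)
open import Data.Fin using (Fin)
open import Data.Product using (Σ; ∃; ∃-syntax; _×_; _,_)
open import Data.Sum using (_⊎_)
open import Data.Unit using (⊤)
open import Data.Empty using (⊥)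
open import Relation.Nullary using (¬_)
open import Relation.Binary.PropositionalEquality using (_≡_; _≢_)

record Graph (n : ℕ) : Set₁ where
  field
    E     : Fin n → Fin n → Set
    sym   : ∀ {a b} → E a b → E b a
    irref : ∀ {a} → ¬ E a a

module _ {n : ℕ} (G : Graph n) where
  open Graph G

  VSet : Set₁
  VSet = Fin n → Set

  _⊆_ : VSet → VSet → Set
  S ⊆ T = ∀ x → S x → T x

  Whole : VSet
  Whole _ = ⊤

  -- Walk of length k from a to b all of whose vertices lie in S
  -- (i.e. a walk in the subgraph induced by S).
  data Walk (S : VSet) : Fin n → Fin n → ℕ → Set where
    nil  : ∀ {a} → S a → Walk S a a zero
    cons : ∀ {a c b k} → S a → E a c → Walk S c b k → Walk S a b (suc k)

  Conn : VSet → Set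
  Conn S = ∀ a b → S a → S b → ∃[ k ] Walk S a b k

  Connected : Set
  Connected = Conn Whole

  Del : VSet → Fin n → VSet
  Del S x y = S y × y ≢ x

  IsCut : Fin n → Set
  IsCut x = ¬ Conn (Del Whole x)

  NoCut : VSet → Set
  NoCut S = ∀ x → S x → Conn (Del S x)

  IsBlock : VSet → Set₁
  IsBlock S = (∃[ x ] S x) × Conn S × NoCut S
            × (∀ T → S ⊆ T → Conn T → NoCut T → T ⊆ S)

  CompleteBipartition : VSet → VSet → VSet → Set
  CompleteBipartition S V1 V2 =
      V1 ⊆ S × V2 ⊆ S
    × (∀ x → S x → V1 x ⊎ V2 x)
    × (∀ x → V1 x → V2 x → ⊥)
    × (∃[ x ] V1 x) × (∃[ x ] V2 x)
    × (∀ x y → V1 x → V1 y → ¬ E x y)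
    × (∀ x y → V2 x → V2 y → ¬ E x y)
    × (∀ x y → V1 x → V2 y → E x y)

  IsBiBlock : Set₁
  IsBiBlock = Connected
    × (∀ S → IsBlock S → ∃[ V1 ] ∃[ V2 ] CompleteBipartition S V1 V2)

  InClassB : Set₁
  InClassB = IsBiBlock
    × (∃[ S ] ∃[ T ] IsBlock S × IsBlock T × ¬ (T ⊆ S))
    × (∀ S → IsBlock S → ∀ x y z → S x → S y → S z
         → IsCut x → IsCut y → IsCut z → x ≡ y ⊎ y ≡ z ⊎ x ≡ z)

  Dist : Fin n → Fin n → ℕ → Set
  Dist a b k = Walk Whole a b k × (∀ m → m < k → ¬ Walk Whole a b m)

  Ecc : Fin n → ℕ → Set
  Ecc u k = (∀ w → ∃[ d ] Dist u w d × d ≤ k) × (∃[ w ] Dist u w k)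

  Diam : ℕ → Set
  Diam D = (∀ u e → Ecc u e → e ≤ D) × (∃[ u ] Ecc u D)

  BridgeWith : VSet → Fin n → Fin n → Set
  BridgeWith S v1 v2 = v1 ≢ v2 × S v1 × S v2 × IsCut v1 × IsCut v2
    × (∀ x → S x → IsCut x → x ≡ v1 ⊎ x ≡ v2)

  LeafWith : VSet → Fin n → Set
  LeafWith S v = S v × IsCut v × (∀ x → S x → IsCut x → x ≡ v)

-- A vertex w outside a block B is reached from u ∈ B only through a cut-vertex of G in B: the
-- first vertex of B met from w has a neighbour outside B, so it is a cut-vertex, since otherwise
-- a path avoiding it back into B would close an ear, contradicting the maximality of B. For a
-- bridge block the same ear argument puts one cut-vertex on every geodesic from the other one
-- to w. Inside the complete bipartite block all distances are at most 2, while diam(G) ≥ 4 keeps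
-- any vertex of B from dominating G − B, so eccentricities of vertices of B are attained outside
-- B. There d(u,w) is the smaller of d(u,v₁) + d(v₁,w) and d(u,v₂) + d(v₂,w), and two
-- computations cover all cases: e(u) = e(v₁) + d(u,v₁) when v₁ lies on a geodesic from u to v₂
-- (leaf blocks, and bridge blocks with u adjacent to exactly one cut-vertex), and
-- e(u) + d(v₁,v₂) = e(v₂) + c when d(u,v₁) = d(u,v₂) = c and e(v₁) ≤ e(v₂).
-- Membership in a block is undecidable, so case distinctions on it are made in the
-- double-negation monad; all goals are inequalities of naturals, hence stable.

module Submission where

open import Defs
open import Level using (0ℓ)
open import Data.Nat using (ℕ; zero; suc; _≤_; _<_; _+_; z≤n; s≤s)
open import Data.Nat.Properties
  using (≤-refl; ≤-trans; ≤-reflexive; ≤-antisym; _≤?_; _<?_; ≮⇒≥; +-comm; +-suc; +-assoc;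
         +-mono-≤; +-monoˡ-≤; +-monoʳ-≤; m≤m+n; n≤1+n; +-cancelʳ-≡; +-identityʳ; module ≤-Reasoning)
open import Data.Fin using (Fin; _≟_)
open import Data.Product using (Σ; ∃-syntax; _×_; _,_; proj₁; proj₂)
open import Data.Sum using (_⊎_; inj₁; inj₂; swap)
open import Data.Unit using (tt; ⊤)
open import Data.Empty using (⊥; ⊥-elim)
open import Data.List using (List; []; _∷_)
open import Data.List.Relation.Unary.Any using (here; there)
open import Data.List.Membership.Propositional using (_∈_; _∉_)
import Data.List.Membership.DecPropositional as DecMembership
open import Effect.Monad using (RawMonad)
open import Relation.Nullary using (¬_; Dec; yes; no)
open import Relation.Nullary.Negation using (¬¬-Monad; DoubleNegation)
open import Relation.Nullary.Decidable using (decidable-stable; ¬¬-excluded-middle)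
open import Relation.Binary.PropositionalEquality using (_≡_; _≢_; refl; sym; trans; cong)

open RawMonad (¬¬-Monad {a = 0ℓ}) using (_>>=_; pure)

module Walks {n : ℕ} (G : Graph n) where
  open Graph G renaming (sym to edge-sym)
  open DecMembership (_≟_ {n}) using (_∈?_)

  walk-start : ∀ {P a b k} → Walk G P a b k → P a
  walk-start (nil s) = s
  walk-start (cons s _ _) = s

  walk-end : ∀ {P a b k} → Walk G P a b k → P b
  walk-end (nil s) = s
  walk-end (cons _ _ w) = walk-end w

  weaken : ∀ {P Q : Fin n → Set} → (∀ x → P x → Q x) → ∀ {a b k} → Walk G P a b k → Walk G Q a b k
  weaken f (nil s) = nil (f _ s)
  weaken f (cons s e w) = cons (f _ s) e (weaken f w)

  append : ∀ {P a b c k m} → Walk G P a b k → Walk G P b c m → Walk G P a c (k + m)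
  append (nil _) w = w
  append (cons s e w) w′ = cons s e (append w w′)

  snoc : ∀ {P a b c k} → Walk G P a b k → E b c → P c → Walk G P a c (suc k)
  snoc (nil s) e p = cons s e (nil p)
  snoc (cons s e w) e′ p = cons s e (snoc w e′ p)

  reverse : ∀ {P a b k} → Walk G P a b k → Walk G P b a k
  reverse (nil s) = nil s
  reverse (cons s e w) = snoc (reverse w) (edge-sym e) s

  walk-length-0 : ∀ {P a b} → Walk G P a b 0 → a ≡ b
  walk-length-0 (nil _) = refl

  walk-length-1 : ∀ {P a b} → Walk G P a b 1 → E a b
  walk-length-1 (cons _ e (nil _)) = e

  vertices : ∀ {P a b k} → Walk G P a b k → List (Fin n)
  vertices (nil {a} _) = a ∷ []
  vertices (cons {a} _ _ w) = a ∷ vertices w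

  start∈vertices : ∀ {P a b k} (w : Walk G P a b k) → a ∈ vertices w
  start∈vertices (nil _) = here refl
  start∈vertices (cons _ _ _) = here refl

  vertices-satisfy : ∀ {P a b k} (w : Walk G P a b k) → ∀ {v} → v ∈ vertices w → P v
  vertices-satisfy (nil s) (here refl) = s
  vertices-satisfy (cons s _ _) (here refl) = s
  vertices-satisfy (cons _ _ w) (there m) = vertices-satisfy w m

  restrict : ∀ {P R : Fin n → Set} {a b k} (w : Walk G P a b k) → (∀ {v} → v ∈ vertices w → R v)
           → Walk G R a b k
  restrict (nil _) f = nil (f (here refl))
  restrict (cons _ e w) f = cons (f (here refl)) e (restrict w (λ m → f (there m)))

  Simple : ∀ {P a b k} → Walk G P a b k → Set
  Simple (nil _) = ⊤
  Simple (cons {a} _ _ w) = a ∉ vertices w × Simple w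

  _⊆ᵛ_ : List (Fin n) → List (Fin n) → Set
  xs ⊆ᵛ ys = ∀ {v} → v ∈ xs → v ∈ ys

  suffix : ∀ {P a b k z} (w : Walk G P a b k) → z ∈ vertices w
         → Σ ℕ λ k′ → Σ (Walk G P z b k′) λ w′ → vertices w′ ⊆ᵛ vertices w × (Simple w → Simple w′)
  suffix (nil s) (here refl) = _ , nil s , (λ m → m) , (λ σ → σ)
  suffix (cons s e w) (here refl) = _ , cons s e w , (λ m → m) , (λ σ → σ)
  suffix (cons s e w) (there m) with suffix w m
  ... | k′ , w′ , sub , simple = k′ , w′ , (λ m′ → there (sub m′)) , (λ σ → simple (proj₂ σ))

  prefix : ∀ {P a b k z} (w : Walk G P a b k) → z ∈ vertices w
         → Σ ℕ λ k′ → Σ (Walk G P a z k′) λ w′ → vertices w′ ⊆ᵛ vertices w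
  prefix (nil s) (here refl) = _ , nil s , (λ m → m)
  prefix (cons s e w) (here refl) = _ , nil s , λ { (here refl) → here refl }
  prefix (cons s e w) (there m) with prefix w m
  ... | k′ , w′ , sub = _ , cons s e w′ , λ { (here refl) → here refl ; (there m′) → there (sub m′) }

  simplify : ∀ {P a b k} (w : Walk G P a b k) → Σ ℕ λ k′ → Σ (Walk G P a b k′) Simple
  simplify (nil s) = _ , nil s , tt
  simplify (cons {a} s e w) with simplify w
  ... | k′ , w′ , σ with a ∈? vertices w′
  ... | yes m with suffix w′ m
  ... | k″ , w″ , _ , simple = k″ , w″ , simple σ
  simplify (cons s e w) | k′ , w′ , σ | no a∉ = _ , cons s e w′ , a∉ , σ

  split-avoiding : ∀ {P a b k} (w : Walk G P a b k) → Simple w → ∀ t z → z ∈ vertices w → z ≢ t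
    → (Σ ℕ λ k′ → Σ (Walk G P a z k′) λ w′ → ∀ {v} → v ∈ vertices w′ → v ∈ vertices w × v ≢ t)
    ⊎ (Σ ℕ λ k′ → Σ (Walk G P z b k′) λ w′ → ∀ {v} → v ∈ vertices w′ → v ∈ vertices w × v ≢ t)
  split-avoiding (nil s) _ t z (here refl) z≢t = inj₁ (_ , nil s , λ { (here refl) → here refl , z≢t })
  split-avoiding (cons s e w) _ t z (here refl) z≢t = inj₁ (_ , nil s , λ { (here refl) → here refl , z≢t })
  split-avoiding (cons {a} s e w) (a∉ , σ) t z (there m) z≢t with t ≟ a
  ... | yes refl with suffix w m
  ... | k′ , w′ , sub , _ = inj₂ (k′ , w′ , λ m′ → there (sub m′) , λ { refl → a∉ (sub m′) })
  split-avoiding (cons {a} s e w) (a∉ , σ) t z (there m) z≢t | no t≢a with split-avoiding w σ t z m z≢t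
  ... | inj₁ (k′ , w′ , avoids) = inj₁ (_ , cons s e w′ ,
          λ { (here refl) → here refl , (λ eq → t≢a (sym eq))
            ; (there m′) → there (proj₁ (avoids m′)) , proj₂ (avoids m′) })
  ... | inj₂ (k′ , w′ , avoids) = inj₂ (k′ , w′ , λ m′ → there (proj₁ (avoids m′)) , proj₂ (avoids m′))

  conn-via-hub : (R : Fin n → Set) (h : Fin n) → (∀ v → R v → ∃[ k ] Walk G R v h k) → Conn G R
  conn-via-hub R h to-hub a b ra rb with to-hub a ra | to-hub b rb
  ... | _ , w | _ , w′ = _ , append w (reverse w′)

module Distances {n : ℕ} (G : Graph n) where
  open Walks G

  dist-≤-walk : ∀ {a b d m} → Dist G a b d → Walk G (Whole G) a b m → d ≤ m
  dist-≤-walk {d = d} {m} (_ , shortest) w with m <? d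
  ... | yes m<d = ⊥-elim (shortest m m<d w)
  ... | no m≮d = ≮⇒≥ m≮d

  dist-refl : ∀ {a} → Dist G a a 0
  dist-refl = nil tt , λ _ ()

  dist-sym : ∀ {a b d} → Dist G a b d → Dist G b a d
  dist-sym (w , shortest) = reverse w , λ m m<d w′ → shortest m m<d (reverse w′)

  dist-triangle : ∀ {a b c x y z} → Dist G a b x → Dist G b c y → Dist G a c z → z ≤ x + y
  dist-triangle (w₁ , _) (w₂ , _) d = dist-≤-walk d (append w₁ w₂)

  dist-pos : ∀ {a b d} → a ≢ b → Dist G a b d → 1 ≤ d
  dist-pos {d = zero} a≢b (w , _) = ⊥-elim (a≢b (walk-length-0 w))
  dist-pos {d = suc _} _ _ = s≤s z≤n

  dist-≤-ecc : ∀ {x y e d} → Ecc G x e → Dist G x y d → d ≤ e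
  dist-≤-ecc {y = y} (bounded , _) d with bounded y
  ... | _ , d′ , d′≤e = ≤-trans (dist-≤-walk d (proj₁ d′)) d′≤e

  distant-pair : (∃[ D ] Diam G D × 4 ≤ D) → ∃[ u ] ∃[ w ] ∀ {m} → Walk G (Whole G) u w m → 4 ≤ m
  distant-pair (_ , (_ , u , _ , w , dist) , 4≤D) = u , w , λ walk → ≤-trans 4≤D (dist-≤-walk dist walk)

  dist-to : ∀ {x e} → Ecc G x e → ∀ w → ∃[ d ] Dist G x w d
  dist-to ecc w with proj₁ ecc w
  ... | d , dist , _ = d , dist

CutVerticesAmong : ∀ {n} → Graph n → (Fin n → Set) → Fin n → Fin n → Set
CutVerticesAmong G S v₁ v₂ = ∀ x → S x → IsCut G x → x ≡ v₁ ⊎ x ≡ v₂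

Nontrivial : ∀ {n} → (Fin n → Set) → Set
Nontrivial S = ∀ x → S x → ∃[ s ] S s × s ≢ x

module Blocks {n : ℕ} (G : Graph n) {S : Fin n → Set} (blk : IsBlock G S) where
  open Graph G renaming (sym to edge-sym)
  open Walks G
  open Distances G

  Outside : Fin n → Set
  Outside v = ¬ S v

  private
    S-connected : Conn G S
    S-connected = proj₁ (proj₂ blk)

    S-no-cut : NoCut G S
    S-no-cut = proj₁ (proj₂ (proj₂ blk))

    S-maximal : ∀ T → (∀ v → S v → T v) → Conn G T → NoCut G T → ∀ v → T v → S v
    S-maximal = proj₂ (proj₂ (proj₂ blk))

  module EarExtension {p q x y k} (p∈S : S p) (q∈S : S q) (p≢q : p ≢ q) (px : E p x) (yq : E y q)
                      (ear : Walk G Outside x y k) (simple : Simple ear) where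
    T : Fin n → Set
    T v = S v ⊎ v ∈ vertices ear

    private
      ear-outside : ∀ {v} → v ∈ vertices ear → ¬ S v
      ear-outside = vertices-satisfy ear

    T-connected : Conn G T
    T-connected = conn-via-hub T p to-p
      where
      to-p : ∀ v → T v → ∃[ k ] Walk G T v p k
      to-p v (inj₁ v∈S) with S-connected v p v∈S p∈S
      ... | _ , w = _ , weaken (λ _ → inj₁) w
      to-p v (inj₂ m) with suffix ear m | S-connected q p q∈S p∈S
      ... | _ , w , sub , _ | _ , w′ =
        _ , append (snoc (restrict w (λ m′ → inj₂ (sub m′))) yq (inj₁ q∈S)) (weaken (λ _ → inj₁) w′)

    -- Without a vertex of S other than p everything still reaches p, without p everything reaches q
    -- through the ear, and without an ear vertex the ear splits into two halves, one attached at
    -- each end.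
    T-no-cut : NoCut G T
    T-no-cut t (inj₁ t∈S) with t ≟ p
    ... | no t≢p = conn-via-hub (Del G T t) p to-p
      where
      to-p : ∀ v → Del G T t v → ∃[ k ] Walk G (Del G T t) v p k
      to-p v (inj₁ v∈S , v≢t) with S-no-cut t t∈S v p (v∈S , v≢t) (p∈S , λ eq → t≢p (sym eq))
      ... | _ , w = _ , weaken (λ _ r → inj₁ (proj₁ r) , proj₂ r) w
      to-p v (inj₂ m , _) with prefix ear m
      ... | _ , w , sub = _ , reverse (cons (inj₁ p∈S , λ eq → t≢p (sym eq)) px
              (restrict w (λ m′ → inj₂ (sub m′) , λ { refl → ear-outside (sub m′) t∈S })))
    ... | yes refl = conn-via-hub (Del G T t) q to-q
      where
      to-q : ∀ v → Del G T t v → ∃[ k ] Walk G (Del G T t) v q k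
      to-q v (inj₁ v∈S , v≢t) with S-no-cut t t∈S v q (v∈S , v≢t) (q∈S , λ eq → p≢q (sym eq))
      ... | _ , w = _ , weaken (λ _ r → inj₁ (proj₁ r) , proj₂ r) w
      to-q v (inj₂ m , _) with suffix ear m
      ... | _ , w , sub , _ =
        _ , snoc (restrict w (λ m′ → inj₂ (sub m′) , λ { refl → ear-outside (sub m′) t∈S }))
                 yq (inj₁ q∈S , λ eq → p≢q (sym eq))
    T-no-cut t (inj₂ t∈ear) = conn-via-hub (Del G T t) p to-p
      where
      S-avoids-t : ∀ {v} → S v → v ≢ t
      S-avoids-t v∈S refl = ear-outside t∈ear v∈S

      to-p : ∀ v → Del G T t v → ∃[ k ] Walk G (Del G T t) v p k
      to-p v (inj₁ v∈S , _) with S-connected v p v∈S p∈S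
      ... | _ , w = _ , weaken (λ _ s → inj₁ s , S-avoids-t s) w
      to-p v (inj₂ m , v≢t) with split-avoiding ear simple t v m v≢t | S-connected q p q∈S p∈S
      ... | inj₁ (_ , w , avoids) | _ = _ , reverse (cons (inj₁ p∈S , S-avoids-t p∈S) px
              (restrict w (λ m′ → inj₂ (proj₁ (avoids m′)) , proj₂ (avoids m′))))
      ... | inj₂ (_ , w , avoids) | _ , w′ =
        _ , append (snoc (restrict w (λ m′ → inj₂ (proj₁ (avoids m′)) , proj₂ (avoids m′)))
                         yq (inj₁ q∈S , S-avoids-t q∈S))
                   (weaken (λ _ s → inj₁ s , S-avoids-t s) w′)

  -- S together with the ear is still connected without cut-vertex, contradicting maximality.
  no-ear : ∀ {p q x y k} → S p → S q → p ≢ q → E p x → E y q → Walk G Outside x y k → ⊥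
  no-ear p∈S q∈S p≢q px yq w with simplify w
  ... | _ , ear , simple =
    walk-start ear (S-maximal T (λ _ → inj₁) T-connected T-no-cut _ (inj₂ (start∈vertices ear)))
    where open EarExtension p∈S q∈S p≢q px yq ear simple

  record Entry (P : Fin n → Set) (w x : Fin n) (d : ℕ) : Set where
    constructor entry
    field
      last-outside first-inside : Fin n
      k₁ k₂ : ℕ
      approach : Walk G (λ v → P v × Outside v) w last-outside k₁
      crossing : E last-outside first-inside
      first-inside∈S : S first-inside
      first-inside∈P : P first-inside
      remainder : Walk G P first-inside x k₂
      length : suc (k₁ + k₂) ≡ d

  first-entry : ∀ {P w x d} → Walk G P w x d → Outside w → S x → DoubleNegation (Entry P w x d)
  first-entry (nil _) w∉S x∈S = ⊥-elim (w∉S x∈S)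
  first-entry (cons {a} {c} pa e rest) a∉S x∈S = ¬¬-excluded-middle {A = S c} >>= λ where
    (yes c∈S) → pure (entry a c 0 _ (nil (pa , a∉S)) e c∈S (walk-start rest) rest refl)
    (no c∉S) → first-entry rest c∉S x∈S >>= λ where
      (entry y z k₁ k₂ approach crossing z∈S z∈P remainder length) →
        pure (entry y z (suc k₁) k₂ (cons (pa , a∉S) e approach) crossing z∈S z∈P remainder (cong suc length))

  -- A walk from y to another vertex of S avoiding x would enter S away from x, closing an ear at x.
  boundary-is-cut : ∀ {s x y} → S s → s ≢ x → S x → Outside y → E x y → IsCut G x
  boundary-is-cut {s} {y = y} s∈S s≢x x∈S y∉S xy connected
    with connected y s (tt , λ { refl → y∉S x∈S }) (tt , s≢x)
  ... | _ , w = first-entry w y∉S s∈S λ where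
    (entry _ z _ _ approach crossing z∈S (_ , z≢x) _ _) →
      no-ear x∈S z∈S (λ eq → z≢x (sym eq)) xy crossing (weaken (λ _ → proj₂) approach)

  entry-is-cut : Nontrivial S → ∀ {P w x d} (ent : Entry P w x d) → IsCut G (Entry.first-inside ent)
  entry-is-cut nontrivial (entry _ z _ _ approach crossing z∈S _ _ _) with nontrivial z z∈S
  ... | _ , s∈S , s≢z = boundary-is-cut s∈S s≢z z∈S (proj₂ (walk-end approach)) (edge-sym crossing)

  entry-bound : ∀ {w x d c a} (ent : Entry (Whole G) w x d)
              → Dist G x (Entry.first-inside ent) c → Dist G (Entry.first-inside ent) w a → c + a ≤ d
  entry-bound {c = c} {a} (entry _ _ k₁ k₂ approach crossing _ _ remainder length) dc da = begin
    c + a               ≤⟨ +-mono-≤ (dist-≤-walk dc (reverse remainder))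
                                    (dist-≤-walk da (reverse (snoc (weaken (λ _ → proj₁) approach) crossing tt))) ⟩
    k₂ + suc k₁         ≡⟨ +-comm k₂ (suc k₁) ⟩
    suc (k₁ + k₂)       ≡⟨ length ⟩
    _                   ∎
    where open ≤-Reasoning

  module WithCutVertices {v₁ v₂ : Fin n} (nontrivial : Nontrivial S) (cuts : CutVerticesAmong G S v₁ v₂) where
    entry-through-cut : ∀ {w x d c₁ a c₂ b} (ent : Entry (Whole G) w x d)
                      → Dist G x v₁ c₁ → Dist G v₁ w a → Dist G x v₂ c₂ → Dist G v₂ w b
                      → c₁ + a ≤ d ⊎ c₂ + b ≤ d
    entry-through-cut ent@(entry _ z _ _ _ _ z∈S _ _ _) dc₁ da dc₂ db with cuts z z∈S (entry-is-cut nontrivial ent)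
    ... | inj₁ refl = inj₁ (entry-bound ent dc₁ da)
    ... | inj₂ refl = inj₂ (entry-bound ent dc₂ db)

    exit-via-cut : ∀ {x w d c₁ a c₂ b} → S x → Outside w → Dist G x w d
                 → Dist G x v₁ c₁ → Dist G v₁ w a → Dist G x v₂ c₂ → Dist G v₂ w b
                 → DoubleNegation (c₁ + a ≤ d ⊎ c₂ + b ≤ d)
    exit-via-cut x∈S w∉S (geodesic , _) dc₁ da dc₂ db =
      first-entry (reverse geodesic) w∉S x∈S >>= λ ent → pure (entry-through-cut ent dc₁ da dc₂ db)

    -- Entering S from w first at v₂ on the way to v₁, and first at v₁ on the way to v₂, closes an ear.
    bridge-separates : v₁ ≢ v₂ → S v₁ → S v₂ → ∀ {w a b δ} → Outside w
                     → Dist G v₁ w a → Dist G v₂ w b → Dist G v₁ v₂ δ → DoubleNegation (δ + a ≤ b ⊎ δ + b ≤ a)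
    bridge-separates v₁≢v₂ v₁∈S v₂∈S {w} {a} {b} {δ} w∉S da db dδ =
      first-entry (reverse (proj₁ da)) w∉S v₁∈S >>= λ ent₁ →
      first-entry (reverse (proj₁ db)) w∉S v₂∈S >>= λ ent₂ →
      pure (separate ent₁ ent₂)
      where
      outside : ∀ {x y k} → Walk G (λ v → ⊤ × Outside v) x y k → Walk G Outside x y k
      outside = weaken (λ _ → proj₂)

      separate : Entry (Whole G) w v₁ a → Entry (Whole G) w v₂ b → δ + a ≤ b ⊎ δ + b ≤ a
      separate ent₁@(entry _ z₁ _ _ approach₁ crossing₁ z₁∈S _ _ _)
               ent₂@(entry _ z₂ _ _ approach₂ crossing₂ z₂∈S _ _ _)
        with cuts z₂ z₂∈S (entry-is-cut nontrivial ent₂) | cuts z₁ z₁∈S (entry-is-cut nontrivial ent₁)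
      ... | inj₁ refl | _ = inj₁ (entry-bound ent₂ (dist-sym dδ) da)
      ... | inj₂ refl | inj₂ refl = inj₂ (entry-bound ent₁ dδ db)
      ... | inj₂ refl | inj₁ refl =
        ⊥-elim (no-ear v₁∈S v₂∈S v₁≢v₂ (edge-sym crossing₁) crossing₂
                       (append (reverse (outside approach₁)) (outside approach₂)))

module CompleteBipartite {n : ℕ} (G : Graph n) where
  open Graph G renaming (sym to edge-sym)
  open Walks G
  open Distances G

  bipartition-swap : ∀ {S V₁ V₂} → CompleteBipartition G S V₁ V₂ → CompleteBipartition G S V₂ V₁
  bipartition-swap (V₁⊆S , V₂⊆S , cover , disjoint , x₁ , x₂ , indep₁ , indep₂ , complete) =
    V₂⊆S , V₁⊆S , (λ x s → swap (cover x s)) , (λ x p q → disjoint x q p) , x₂ , x₁ , indep₂ , indep₁ ,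
    (λ x y p q → edge-sym (complete y x q p))

  bipartition-cover : ∀ {S V₁ V₂} → CompleteBipartition G S V₁ V₂ → ∀ x → S x → V₁ x ⊎ V₂ x
  bipartition-cover (_ , _ , cover , _) = cover

  dist-across : ∀ {S V₁ V₂ x y} → CompleteBipartition G S V₁ V₂ → V₁ x → V₂ y → Dist G x y 1
  dist-across {x = x} {y} (_ , _ , _ , disjoint , _ , _ , _ , _ , complete) x∈V₁ y∈V₂ =
    cons tt (complete x y x∈V₁ y∈V₂) (nil tt) , shortest
    where
    shortest : ∀ m → m < 1 → ¬ Walk G (Whole G) x y m
    shortest zero _ w with walk-length-0 w
    ... | refl = disjoint x x∈V₁ y∈V₂
    shortest (suc _) (s≤s ()) _

  dist-same-side : ∀ {S V₁ V₂ x y} → CompleteBipartition G S V₁ V₂ → V₁ x → V₁ y → x ≢ y → Dist G x y 2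
  dist-same-side {x = x} {y} (_ , _ , _ , _ , _ , (x₂ , x₂∈V₂) , indep₁ , _ , complete) x∈V₁ y∈V₁ x≢y =
    cons tt (complete x x₂ x∈V₁ x₂∈V₂) (cons tt (edge-sym (complete y x₂ y∈V₁ x₂∈V₂)) (nil tt)) , shortest
    where
    shortest : ∀ m → m < 2 → ¬ Walk G (Whole G) x y m
    shortest zero _ w = x≢y (walk-length-0 w)
    shortest (suc zero) _ w = indep₁ x y x∈V₁ y∈V₁ (walk-length-1 w)
    shortest (suc (suc _)) (s≤s (s≤s ())) _

  walk-same-side : ∀ {S V₁ V₂ x y} → CompleteBipartition G S V₁ V₂ → V₁ x → V₁ y
                 → ∃[ k ] k ≤ 2 × Walk G (Whole G) x y k
  walk-same-side {x = x} {y} bip x∈V₁ y∈V₁ with x ≟ y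
  ... | yes refl = 0 , z≤n , nil tt
  ... | no x≢y = 2 , ≤-refl , proj₁ (dist-same-side bip x∈V₁ y∈V₁ x≢y)

  walk-within : ∀ {S V₁ V₂ x y} → CompleteBipartition G S V₁ V₂ → S x → S y
              → ∃[ k ] k ≤ 2 × Walk G (Whole G) x y k
  walk-within {x = x} {y} bip x∈S y∈S with bipartition-cover bip x x∈S | bipartition-cover bip y y∈S
  ... | inj₁ x∈V₁ | inj₂ y∈V₂ = 1 , s≤s z≤n , proj₁ (dist-across bip x∈V₁ y∈V₂)
  ... | inj₂ x∈V₂ | inj₁ y∈V₁ = 1 , s≤s z≤n , reverse (proj₁ (dist-across bip y∈V₁ x∈V₂))
  ... | inj₁ x∈V₁ | inj₁ y∈V₁ = walk-same-side bip x∈V₁ y∈V₁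
  ... | inj₂ x∈V₂ | inj₂ y∈V₂ = walk-same-side (bipartition-swap bip) x∈V₂ y∈V₂

  dist-within : ∀ {S V₁ V₂ x y d} → CompleteBipartition G S V₁ V₂ → S x → S y → Dist G x y d → d ≤ 2
  dist-within bip x∈S y∈S dist with walk-within bip x∈S y∈S
  ... | _ , k≤2 , w = ≤-trans (dist-≤-walk dist w) k≤2

  bipartite-nontrivial : ∀ {S V₁ V₂} → CompleteBipartition G S V₁ V₂ → Nontrivial S
  bipartite-nontrivial (V₁⊆S , V₂⊆S , cover , disjoint , (x₁ , x₁∈V₁) , (x₂ , x₂∈V₂) , _) x x∈S with cover x x∈S
  ... | inj₁ x∈V₁ = x₂ , V₂⊆S x₂ x₂∈V₂ , λ { refl → disjoint x x∈V₁ x₂∈V₂ }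
  ... | inj₂ x∈V₂ = x₁ , V₁⊆S x₁ x₁∈V₁ , λ { refl → disjoint x x₁∈V₁ x∈V₂ }

module LargeDiameter {n : ℕ} (G : Graph n) (diam : ∃[ D ] Diam G D × 4 ≤ D)
                     {S V₁ V₂ : Fin n → Set} (bip : CompleteBipartition G S V₁ V₂) where
  open Graph G renaming (sym to edge-sym)
  open Walks G
  open Distances G
  open CompleteBipartite G

  -- Otherwise any two vertices are joined by a walk of length at most 3 through h.
  no-outer-dominator : ∀ {h} → S h → ¬ (∀ w → ¬ S w → E h w)
  no-outer-dominator h∈S dominates with distant-pair diam
  ... | u , w , far = ¬¬-excluded-middle λ u? → ¬¬-excluded-middle λ w? → too-close (short-walk u? w?)
    where
    too-close : ¬ (∃[ m ] m ≤ 3 × Walk G (Whole G) u w m)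
    too-close (_ , m≤3 , walk) with ≤-trans (far walk) m≤3
    ... | s≤s (s≤s (s≤s ()))

    short-walk : Dec (S u) → Dec (S w) → ∃[ m ] m ≤ 3 × Walk G (Whole G) u w m
    short-walk (yes u∈S) (yes w∈S) with walk-within bip u∈S w∈S
    ... | m , m≤2 , walk = m , ≤-trans m≤2 (n≤1+n 2) , walk
    short-walk (yes u∈S) (no w∉S) with walk-within bip u∈S h∈S
    ... | m , m≤2 , walk = suc m , s≤s m≤2 , snoc walk (dominates w w∉S) tt
    short-walk (no u∉S) (yes w∈S) with walk-within bip h∈S w∈S
    ... | m , m≤2 , walk = suc m , s≤s m≤2 , cons tt (edge-sym (dominates u u∉S)) walk
    short-walk (no u∉S) (no w∉S) =
      2 , n≤1+n 2 , cons tt (edge-sym (dominates u u∉S)) (cons tt (dominates w w∉S) (nil tt))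

  far-outside-vertex : ∀ {h e} → S h → Ecc G h e → DoubleNegation (∃[ w ] ¬ S w × ∃[ d ] Dist G h w d × 2 ≤ d)
  far-outside-vertex {h} h∈S ecc none = no-outer-dominator h∈S adjacent
    where
    adjacent : ∀ w → ¬ S w → E h w
    adjacent w w∉S with dist-to ecc w
    ... | zero , dist with walk-length-0 (proj₁ dist)
    ...   | refl = ⊥-elim (w∉S h∈S)
    adjacent w w∉S | suc zero , dist = walk-length-1 (proj₁ dist)
    adjacent w w∉S | suc (suc d) , dist = ⊥-elim (none (w , w∉S , _ , dist , s≤s (s≤s z≤n)))

  ecc-attained-outside : ∀ {h e} → S h → Ecc G h e → DoubleNegation (∃[ w ] ¬ S w × ∃[ d ] Dist G h w d × e ≤ d)
  ecc-attained-outside {e = e} h∈S ecc@(_ , wₑ , distₑ) = ¬¬-excluded-middle >>= λ where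
    (no wₑ∉S) → pure (wₑ , wₑ∉S , e , distₑ , ≤-refl)
    (yes wₑ∈S) → far-outside-vertex h∈S ecc >>= λ where
      (w , w∉S , d , dist , 2≤d) → pure (w , w∉S , d , dist , ≤-trans (dist-within bip h∈S wₑ∈S distₑ) 2≤d)

≤-stable : ∀ {m n} → DoubleNegation (m ≤ n) → m ≤ n
≤-stable {m} {n} = decidable-stable (m ≤? n)

module Eccentricity {n : ℕ} (G : Graph n) (diam : ∃[ D ] Diam G D × 4 ≤ D)
                    {S V₁ V₂ : Fin n → Set} (blk : IsBlock G S) (bip : CompleteBipartition G S V₁ V₂)
                    {v₁ v₂ : Fin n} (cuts : CutVerticesAmong G S v₁ v₂) (v₁∈S : S v₁) (v₂∈S : S v₂)
                    {e₁ e₂ : ℕ} (ecc₁ : Ecc G v₁ e₁) (ecc₂ : Ecc G v₂ e₂) where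
  open Distances G
  open CompleteBipartite G
  open LargeDiameter G diam bip
  open Blocks G blk
  open WithCutVertices (bipartite-nontrivial bip) cuts
  open ≤-Reasoning

  ecc-via-cut : ∀ {u c c′ δ eᵤ} → S u → Dist G u v₁ c → Dist G u v₂ c′ → Dist G v₁ v₂ δ → c + δ ≤ c′
              → Ecc G u eᵤ → eᵤ ≡ e₁ + c
  ecc-via-cut {c = c} {c′} {δ} {eᵤ} u∈S dc dc′ dδ c+δ≤c′ eccᵤ = ≤-antisym upper (≤-stable lower)
    where
    upper : eᵤ ≤ e₁ + c
    upper with proj₂ eccᵤ
    ... | wᵤ , distᵤ with dist-to ecc₁ wᵤ
    ... | a , da = begin
      eᵤ      ≤⟨ dist-triangle dc da distᵤ ⟩
      c + a   ≤⟨ +-monoʳ-≤ c (dist-≤-ecc ecc₁ da) ⟩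
      c + e₁  ≡⟨ +-comm c e₁ ⟩
      e₁ + c  ∎

    lower-from : ∀ {w a} → ¬ S w → Dist G v₁ w a → e₁ ≤ a → DoubleNegation (e₁ + c ≤ eᵤ)
    lower-from {w} {a} w∉S da e₁≤a with dist-to eccᵤ w | dist-to ecc₂ w
    ... | d , dist | b , db = exit-via-cut u∈S w∉S dist dc da dc′ db >>= λ where
      (inj₁ c+a≤d) → pure (begin
        e₁ + c        ≤⟨ +-monoˡ-≤ c e₁≤a ⟩
        a + c         ≡⟨ +-comm a c ⟩
        c + a         ≤⟨ c+a≤d ⟩
        d             ≤⟨ dist-≤-ecc eccᵤ dist ⟩
        eᵤ            ∎)
      (inj₂ c′+b≤d) → pure (begin
        e₁ + c        ≤⟨ +-monoˡ-≤ c (≤-trans e₁≤a (dist-triangle dδ db da)) ⟩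
        (δ + b) + c   ≡⟨ +-comm (δ + b) c ⟩
        c + (δ + b)   ≡⟨ +-assoc c δ b ⟨
        (c + δ) + b   ≤⟨ +-monoˡ-≤ b c+δ≤c′ ⟩
        c′ + b        ≤⟨ c′+b≤d ⟩
        d             ≤⟨ dist-≤-ecc eccᵤ dist ⟩
        eᵤ            ∎)

    lower : DoubleNegation (e₁ + c ≤ eᵤ)
    lower = ecc-attained-outside v₁∈S ecc₁ >>= λ (_ , w∉S , _ , da , e₁≤a) → lower-from w∉S da e₁≤a

  module _ (v₁≢v₂ : v₁ ≢ v₂) (e₁≤e₂ : e₁ ≤ e₂) {δ : ℕ} (dδ : Dist G v₁ v₂ δ) where

    cut-distance<ecc : δ < e₂
    cut-distance<ecc = ≤-stable (ecc-attained-outside v₁∈S ecc₁ >>= λ (w , w∉S , _ , da , _) → beyond w∉S da)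
      where
      beyond : ∀ {w a} → ¬ S w → Dist G v₁ w a → DoubleNegation (δ < e₂)
      beyond {w} {a} w∉S da with dist-to ecc₂ w
      ... | b , db = bridge-separates v₁≢v₂ v₁∈S v₂∈S w∉S da db dδ >>= λ where
        (inj₁ δ+a≤b) → pure (begin
          1 + δ   ≤⟨ +-monoˡ-≤ δ (dist-pos (λ { refl → w∉S v₁∈S }) da) ⟩
          a + δ   ≡⟨ +-comm a δ ⟩
          δ + a   ≤⟨ δ+a≤b ⟩
          b       ≤⟨ dist-≤-ecc ecc₂ db ⟩
          e₂      ∎)
        (inj₂ δ+b≤a) → pure (begin
          1 + δ   ≤⟨ +-monoˡ-≤ δ (dist-pos (λ { refl → w∉S v₂∈S }) db) ⟩
          b + δ   ≡⟨ +-comm b δ ⟩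
          δ + b   ≤⟨ δ+b≤a ⟩
          a       ≤⟨ dist-≤-ecc ecc₁ da ⟩
          e₁      ≤⟨ e₁≤e₂ ⟩
          e₂      ∎)

    ecc-equidistant : ∀ {u c eᵤ} → S u → u ≢ v₁ → Dist G u v₁ c → Dist G u v₂ c → Ecc G u eᵤ
                    → eᵤ + δ ≡ e₂ + c
    ecc-equidistant {c = c} {eᵤ} u∈S u≢v₁ dc₁ dc₂ eccᵤ@(_ , wᵤ , distᵤ) =
      ≤-antisym (≤-stable upper) (≤-stable lower)
      where
      shuffle : ∀ x → (c + x) + δ ≡ c + (δ + x)
      shuffle x = trans (+-assoc c x δ) (cong (c +_) (+-comm x δ))

      upper-outside : ¬ S wᵤ → DoubleNegation (eᵤ + δ ≤ e₂ + c)
      upper-outside wᵤ∉S with dist-to ecc₁ wᵤ | dist-to ecc₂ wᵤ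
      ... | a , da | b , db = bridge-separates v₁≢v₂ v₁∈S v₂∈S wᵤ∉S da db dδ >>= λ where
        (inj₁ δ+a≤b) → pure (begin
          eᵤ + δ        ≤⟨ +-monoˡ-≤ δ (dist-triangle dc₁ da distᵤ) ⟩
          (c + a) + δ   ≡⟨ shuffle a ⟩
          c + (δ + a)   ≤⟨ +-monoʳ-≤ c (≤-trans δ+a≤b (dist-≤-ecc ecc₂ db)) ⟩
          c + e₂        ≡⟨ +-comm c e₂ ⟩
          e₂ + c        ∎)
        (inj₂ δ+b≤a) → pure (begin
          eᵤ + δ        ≤⟨ +-monoˡ-≤ δ (dist-triangle dc₂ db distᵤ) ⟩
          (c + b) + δ   ≡⟨ shuffle b ⟩
          c + (δ + b)   ≤⟨ +-monoʳ-≤ c (≤-trans δ+b≤a (≤-trans (dist-≤-ecc ecc₁ da) e₁≤e₂)) ⟩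
          c + e₂        ≡⟨ +-comm c e₂ ⟩
          e₂ + c        ∎)

      upper : DoubleNegation (eᵤ + δ ≤ e₂ + c)
      upper = ¬¬-excluded-middle >>= λ where
        (yes wᵤ∈S) → pure (begin
          eᵤ + δ        ≤⟨ +-monoˡ-≤ δ (dist-within bip u∈S wᵤ∈S distᵤ) ⟩
          1 + (1 + δ)   ≤⟨ +-mono-≤ (dist-pos u≢v₁ dc₁) cut-distance<ecc ⟩
          c + e₂        ≡⟨ +-comm c e₂ ⟩
          e₂ + c        ∎)
        (no wᵤ∉S) → upper-outside wᵤ∉S

      lower-from : ∀ {w b} → ¬ S w → Dist G v₂ w b → e₂ ≤ b → DoubleNegation (e₂ + c ≤ eᵤ + δ)
      lower-from {w} {b} w∉S db e₂≤b with dist-to eccᵤ w | dist-to ecc₁ w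
      ... | d , dist | a , da = exit-via-cut u∈S w∉S dist dc₁ da dc₂ db >>= λ where
        (inj₁ c+a≤d) → pure (begin
          e₂ + c        ≤⟨ +-monoˡ-≤ c (≤-trans e₂≤b (dist-triangle (dist-sym dδ) da db)) ⟩
          (δ + a) + c   ≡⟨ +-comm (δ + a) c ⟩
          c + (δ + a)   ≡⟨ shuffle a ⟨
          (c + a) + δ   ≤⟨ +-monoˡ-≤ δ (≤-trans c+a≤d (dist-≤-ecc eccᵤ dist)) ⟩
          eᵤ + δ        ∎)
        (inj₂ c+b≤d) → pure (begin
          e₂ + c        ≤⟨ +-monoˡ-≤ c e₂≤b ⟩
          b + c         ≡⟨ +-comm b c ⟩
          c + b         ≤⟨ ≤-trans c+b≤d (dist-≤-ecc eccᵤ dist) ⟩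
          eᵤ            ≤⟨ m≤m+n eᵤ δ ⟩
          eᵤ + δ        ∎)

      lower : DoubleNegation (e₂ + c ≤ eᵤ + δ)
      lower = ecc-attained-outside v₂∈S ecc₂ >>= λ (_ , w∉S , _ , db , e₂≤b) → lower-from w∉S db e₂≤b

module _ {n : ℕ} (G : Graph n) (diam : ∃[ D ] Diam G D × 4 ≤ D)
         {S V₁ V₂ : Fin n → Set} (blk : IsBlock G S) (bip : CompleteBipartition G S V₁ V₂)
         {u : Fin n} (u∈S : S u) (u-not-cut : ¬ IsCut G u) where
  open Distances G
  open CompleteBipartite G

  private
    ≢-cut : ∀ {v} → IsCut G v → u ≢ v
    ≢-cut v-cut refl = u-not-cut v-cut

  leaf-eccentricities : ∀ v → LeafWith G S v → ∀ eᵥ eᵤ → Ecc G v eᵥ → Ecc G u eᵤ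
    → ((V₁ u × V₁ v) ⊎ (V₂ u × V₂ v) → eᵤ ≡ eᵥ + 2)
    × (¬ ((V₁ u × V₁ v) ⊎ (V₂ u × V₂ v)) → eᵤ ≡ eᵥ + 1)
  leaf-eccentricities v (v∈S , v-cut , cuts) eᵥ eᵤ eccᵥ eccᵤ = same-side , opposite-sides
    where
    open Eccentricity G diam blk bip (λ x x∈S x-cut → inj₁ (cuts x x∈S x-cut)) v∈S v∈S eccᵥ eccᵥ

    leaf-ecc : ∀ {c} → Dist G u v c → eᵤ ≡ eᵥ + c
    leaf-ecc {c} dc = ecc-via-cut u∈S dc dc dist-refl (≤-reflexive (+-identityʳ c)) eccᵤ

    same-side : (V₁ u × V₁ v) ⊎ (V₂ u × V₂ v) → eᵤ ≡ eᵥ + 2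
    same-side (inj₁ (u∈V₁ , v∈V₁)) = leaf-ecc (dist-same-side bip u∈V₁ v∈V₁ (≢-cut v-cut))
    same-side (inj₂ (u∈V₂ , v∈V₂)) = leaf-ecc (dist-same-side (bipartition-swap bip) u∈V₂ v∈V₂ (≢-cut v-cut))

    opposite-sides : ¬ ((V₁ u × V₁ v) ⊎ (V₂ u × V₂ v)) → eᵤ ≡ eᵥ + 1
    opposite-sides different with bipartition-cover bip u u∈S | bipartition-cover bip v v∈S
    ... | inj₁ u∈V₁ | inj₁ v∈V₁ = ⊥-elim (different (inj₁ (u∈V₁ , v∈V₁)))
    ... | inj₂ u∈V₂ | inj₂ v∈V₂ = ⊥-elim (different (inj₂ (u∈V₂ , v∈V₂)))
    ... | inj₁ u∈V₁ | inj₂ v∈V₂ = leaf-ecc (dist-across bip u∈V₁ v∈V₂)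
    ... | inj₂ u∈V₂ | inj₁ v∈V₁ = leaf-ecc (dist-sym (dist-across bip v∈V₁ u∈V₂))

  bridge-eccentricities : ∀ v₁ v₂ → BridgeWith G S v₁ v₂
    → ∀ e₁ e₂ eᵤ → Ecc G v₁ e₁ → Ecc G v₂ e₂ → Ecc G u eᵤ → e₁ ≤ e₂
    → (V₁ v₁ → V₁ v₂ → V₁ u → eᵤ ≡ e₂)
    × (V₁ v₁ → V₁ v₂ → V₂ u → suc eᵤ ≡ e₂)
    × (V₁ v₁ → V₁ u → V₂ v₂ → eᵤ ≡ suc e₂)
    × (V₁ v₁ → V₂ v₂ → V₂ u → eᵤ ≡ suc e₁)
  bridge-eccentricities v₁ v₂ (v₁≢v₂ , v₁∈S , v₂∈S , v₁-cut , v₂-cut , cuts) e₁ e₂ eᵤ ecc₁ ecc₂ eccᵤ e₁≤e₂ =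
    all-same-side , u-opposite-cuts , near-v₂ , near-v₁
    where
    open Eccentricity G diam blk bip cuts v₁∈S v₂∈S ecc₁ ecc₂
    open Eccentricity G diam blk bip (λ x x∈S x-cut → swap (cuts x x∈S x-cut)) v₂∈S v₁∈S ecc₂ ecc₁
      using () renaming (ecc-via-cut to ecc-via-cut₂)

    all-same-side : V₁ v₁ → V₁ v₂ → V₁ u → eᵤ ≡ e₂
    all-same-side v₁∈V₁ v₂∈V₁ u∈V₁ = +-cancelʳ-≡ 2 eᵤ e₂
      (ecc-equidistant v₁≢v₂ e₁≤e₂ (dist-same-side bip v₁∈V₁ v₂∈V₁ v₁≢v₂) u∈S (≢-cut v₁-cut)
        (dist-same-side bip u∈V₁ v₁∈V₁ (≢-cut v₁-cut)) (dist-same-side bip u∈V₁ v₂∈V₁ (≢-cut v₂-cut)) eccᵤ)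

    u-opposite-cuts : V₁ v₁ → V₁ v₂ → V₂ u → suc eᵤ ≡ e₂
    u-opposite-cuts v₁∈V₁ v₂∈V₁ u∈V₂ = +-cancelʳ-≡ 1 (suc eᵤ) e₂ (trans (sym (+-suc eᵤ 1))
      (ecc-equidistant v₁≢v₂ e₁≤e₂ (dist-same-side bip v₁∈V₁ v₂∈V₁ v₁≢v₂) u∈S (≢-cut v₁-cut)
        (dist-sym (dist-across bip v₁∈V₁ u∈V₂)) (dist-sym (dist-across bip v₂∈V₁ u∈V₂)) eccᵤ))

    near-v₂ : V₁ v₁ → V₁ u → V₂ v₂ → eᵤ ≡ suc e₂
    near-v₂ v₁∈V₁ u∈V₁ v₂∈V₂ = trans
      (ecc-via-cut₂ u∈S (dist-across bip u∈V₁ v₂∈V₂) (dist-same-side bip u∈V₁ v₁∈V₁ (≢-cut v₁-cut))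
        (dist-sym (dist-across bip v₁∈V₁ v₂∈V₂)) ≤-refl eccᵤ)
      (+-comm e₂ 1)

    near-v₁ : V₁ v₁ → V₂ v₂ → V₂ u → eᵤ ≡ suc e₁
    near-v₁ v₁∈V₁ v₂∈V₂ u∈V₂ = trans
      (ecc-via-cut u∈S (dist-sym (dist-across bip v₁∈V₁ u∈V₂))
        (dist-same-side (bipartition-swap bip) u∈V₂ v₂∈V₂ (≢-cut v₂-cut))
        (dist-across bip v₁∈V₁ v₂∈V₂) ≤-refl eccᵤ)
      (+-comm e₁ 1)

lemma3p9 : ∀ {n} (G : Graph n) → InClassB G
    → (∃[ D ] Diam G D × 4 ≤ D)
    → ∀ (S V1 V2 : Fin n → Set) → IsBlock G S → CompleteBipartition G S V1 V2
    → ∀ u → S u → ¬ IsCut G u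
    → (∀ v1 v2 → BridgeWith G S v1 v2
        → ∀ e1 e2 eu → Ecc G v1 e1 → Ecc G v2 e2 → Ecc G u eu → e1 ≤ e2
        → (V1 v1 → V1 v2 → V1 u → eu ≡ e2)
        × (V1 v1 → V1 v2 → V2 u → suc eu ≡ e2)
        × (V1 v1 → V1 u → V2 v2 → eu ≡ suc e2)
        × (V1 v1 → V2 v2 → V2 u → eu ≡ suc e1))
    × (∀ v → LeafWith G S v → ∀ ev eu → Ecc G v ev → Ecc G u eu
        → ((V1 u × V1 v) ⊎ (V2 u × V2 v) → eu ≡ ev + 2)
        × (¬ ((V1 u × V1 v) ⊎ (V2 u × V2 v)) → eu ≡ ev + 1))
lemma3p9 G _ diam S V₁ V₂ blk bip u u∈S u-not-cut =
  bridge-eccentricities G diam blk bip u∈S u-not-cut , leaf-eccentricities G diam blk bip u∈S u-not-cut
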